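{- Let $N=((V,E),\mathcal{S},\mathcal{T},f)$ be a node-capacitated multicommodity instance and let $(\mathbb{F},r,\pi,L)$ be a linear network code for $N$ describing a coding solution consisting of $r$ node-disjoint paths, i.e. $L$ has $r$ columns, the $j$-th column being the indicator vector of a path $P_j$ in $G$ that starts at a vertex of $f(s_i)$ and ends at a vertex of $f(t_i)$ for the pair $i$ whose message it carries, the paths $P_1,\dots,P_r$ being pairwise vertex-disjoint, and $\pi$ increasing along each path. Then this code is $r$-certifiable.
   Context: A node-capacitated multicommodity instance is a tuple $N=(G,\mathcal{S},\mathcal{T},f)$ where $G=(V,E)$ is a finite undirected graph, $\mathcal{S}=(s_1,\dots,s_k)$, $\mathcal{T}=(t_1,\dots,t_k)$ are ordered lists of sources and sinks (not in $V$), $s_i$ paired with $t_i$, and $f:\mathcal{S}\cup\mathcal{T}\to2^V$. The network is $G$ (edges usable in both directions) plus a node for each source and sink and directed edges $(s,v)$, $v\in f(s)$, and $(u,t)$, $u\in f(t)$. For $v\in V$, $f^{ -1}(v)$ is the set of sources $s$ with $v\in f(s)$. Linear network code $(\mathbb{F},r,\pi,L)$, $n=|V|$: finite field $\mathbb{F}$, $r:\mathcal{S}\to\mathbb{N}$, a bijection $\pi:V\to\{1,\dots,n\}$, and an $n\times\sum_s r(s)$ matrix $L$ with rows indexed by $V$ and columns by messages $\mathcal{M}=\bigcup_s\mathcal{M}(s)$, $\mathcal{M}(s)=\{(s,1),\dots,(s,r(s))\}$, such that, with $N(v)=\{v\}\cup\{u:\pi(u)<\pi(v),uv\in E\}$,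 each $v$ has $a_v\in\mathbb{F}^{1\times n}$ with $\{v\}\subseteq\mathsf{supp}(a_v)\subseteq N(v)$ and $\mathsf{supp}(a_vL)\subseteq\bigcup_{s\in f^{ -1}(v)}\mathcal{M}(s)$ (supp = set of indices of nonzero entries). A multicut is a set $M\subseteq V$ whose deletion disconnects every $s_i$ from $t_i$. $I_M$ is the $n\times|M|$ matrix with $I_M[v,w]=1$ iff $v=w$. The code is $\rho$-certifiable if (1) there are cliques $K(v)\subseteq N(v)$ of $G$ such that the requirements above still hold with $N(v)$ replaced by $K(v)$ for every $v$, and (2) $\mathsf{rank}(L^TI_M)\ge\rho$ for every multicut $M$. -}

module Defs where

open import Level using (Level; _⊔_) renaming (suc to lsuc)
open import Data.Nat as ℕ using (ℕ)
open import Data.Fin as Fin using (Fin; _≟_)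
open import Data.Fin.Subset using (Subset; _∈_; _∉_)
open import Data.Fin.Permutation using (Permutation′; _⟨$⟩ʳ_)
open import Data.List using (List)
open import Data.List.NonEmpty as List⁺ using (List⁺)
open import Data.List.Relation.Unary.Any using (Any)
open import Data.List.Relation.Unary.Linked using (Linked)
open import Data.List.Relation.Unary.Unique.Propositional using (Unique)
import Data.List.Membership.Propositional as ListMem
open import Data.Product using (Σ; Σ-syntax; ∃; ∃-syntax; _×_; _,_)
open import Data.Sum using (_⊎_)
open import Relation.Nullary using (¬_; yes; no)
open import Relation.Binary.PropositionalEquality using (_≡_; _≢_)
open import Function.Definitions using (Injective)
open import Algebra.Bundles using (CommutativeRing)

record FiniteField (c ℓ : Level) : Set (lsuc (c ⊔ ℓ)) where
  field
    commutativeRing : CommutativeRing c ℓ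
  open CommutativeRing commutativeRing public
  field
    1≉0     : ¬ (1# ≈ 0#)
    inverse : ∀ x → ¬ (x ≈ 0#) → Σ[ y ∈ Carrier ] (x * y ≈ 1#)
    elements : List Carrier
    complete : ∀ x → Any (x ≈_) elements

sumFin : ∀ {a} {A : Set a} → (A → A → A) → A → ∀ n → (Fin n → A) → A
sumFin _+_ z ℕ.zero    g = z
sumFin _+_ z (ℕ.suc n) g = g Fin.zero + sumFin _+_ z n (λ i → g (Fin.suc i))

record Graph (n : ℕ) : Set₁ where
  field
    Adj     : Fin n → Fin n → Set
    Adj-sym : ∀ {u v} → Adj u v → Adj v u

IsClique : ∀ {n} → Graph n → (Fin n → Set) → Set
IsClique G K = ∀ x y → K x → K y → x ≢ y → Graph.Adj G x y

-- Node-capacitated multicommodity instances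
-- k commodity pairs (s_i , t_i), i : Fin k;  f(s_i) = fS i, f(t_i) = fT i.

record Instance (n k : ℕ) : Set₁ where
  field
    G  : Graph n
    fS : Fin k → Subset n
    fT : Fin k → Subset n
  open Graph G public

module _ {n k : ℕ} (N : Instance n k) where
  open Instance N

  record WalkFor (i : Fin k) (P : List⁺ (Fin n)) : Set where
    field
      linked : Linked Adj (List⁺.toList P)
      start  : List⁺.head P ∈ fS i
      end    : List⁺.last P ∈ fT i

  record PathFor (i : Fin k) (P : List⁺ (Fin n)) : Set where
    field
      walk   : WalkFor i P
      unique : Unique (List⁺.toList P)

  -- M is a multicut: deleting M disconnects every s_i from t_i, i.e. every
  -- s_i → t_i route in the network (s_i → v₀ – … – v_ℓ → t_i) meets M
  IsMulticut : Subset n → Set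
  IsMulticut M = ∀ i P → WalkFor i P → Any (_∈ M) (List⁺.toList P)

-- messages M = ⋃_s M(s), M(s_i) = {(i,1),…,(i, r i)}
Msg : ∀ {k} → (Fin k → ℕ) → Set
Msg {k} r = Σ[ i ∈ Fin k ] Fin (r i)

module _ {c ℓ : Level} (F : FiniteField c ℓ) where
  open FiniteField F

  ∑ : ∀ m → (Fin m → Carrier) → Carrier
  ∑ = sumFin _+_ 0#

  Matrix : Set → Set → Set c
  Matrix R C = R → C → Carrier

  _ᵀ : ∀ {R C} → Matrix R C → Matrix C R
  (A ᵀ) x y = A y x

  _·_ : ∀ {R C n} → Matrix R (Fin n) → Matrix (Fin n) C → Matrix R C
  _·_ {n = n} A B x y = ∑ n (λ j → A x j * B j y)

  I[_] : ∀ {n} (M : Subset n) → Matrix (Fin n) (Σ[ w ∈ Fin n ] w ∈ M)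
  I[ M ] v (w , _) with v ≟ w
  ... | yes _ = 1#
  ... | no  _ = 0#

  SuppIn : ∀ {X : Set} → (X → Carrier) → (X → Set) → Set ℓ
  SuppIn a P = ∀ x → ¬ (a x ≈ 0#) → P x

  RankAtLeast : ∀ {R C} → Matrix R C → ℕ → Set (c ⊔ ℓ)
  RankAtLeast {R} {C} A ρ =
    Σ[ sel ∈ (Fin ρ → C) ] (Injective _≡_ _≡_ sel ×
      (∀ (λs : Fin ρ → Carrier) →
         (∀ x → ∑ ρ (λ j → λs j * A x (sel j)) ≈ 0#) →
         ∀ j → λs j ≈ 0#))

  module _ {n k : ℕ} (N : Instance n k) where
    open Instance N

    record Code : Set c where
      field
        r : Fin k → ℕ
        π : Permutation′ n
        L : Matrix (Fin n) (Msg r)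

    module _ (C : Code) where
      open Code C

      Nbhd : Fin n → Fin n → Set
      Nbhd v u = u ≡ v ⊎ ((π ⟨$⟩ʳ u) Fin.< (π ⟨$⟩ʳ v) × Adj u v)

      Requirement : Fin n → (Fin n → Set) → Set (c ⊔ ℓ)
      Requirement v K =
        Σ[ a ∈ (Fin n → Carrier) ]
          (¬ (a v ≈ 0#) ×
           SuppIn a K ×
           SuppIn (λ m → ∑ n (λ u → a u * L u m))
                  (λ m → v ∈ fS (Data.Product.proj₁ m)))

      IsLinearCode : Set (c ⊔ ℓ)
      IsLinearCode = ∀ v → Requirement v (Nbhd v)

      totalMsgs : ℕ
      totalMsgs = sumFin ℕ._+_ 0 k r

      Certifiable : ℕ → Set (lsuc Level.zero ⊔ c ⊔ ℓ)
      Certifiable ρ =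
        (Σ[ K ∈ (Fin n → Fin n → Set) ]
           (∀ v → (∀ u → K v u → Nbhd v u)
                × IsClique G (K v)
                × Requirement v (K v)))
        × (∀ M → IsMulticut N M → RankAtLeast ((L ᵀ) · I[ M ]) ρ)

      open ListMem using () renaming (_∈_ to _∈ₗ_)
      DescribesDisjointPaths : Set ℓ
      DescribesDisjointPaths =
        Σ[ P ∈ (Msg r → List⁺ (Fin n)) ]
          ((∀ m → PathFor N (Data.Product.proj₁ m) (P m))
         × (∀ m → Linked (λ u v → (π ⟨$⟩ʳ u) Fin.< (π ⟨$⟩ʳ v)) (List⁺.toList (P m)))
         × (∀ v m → (v ∈ₗ List⁺.toList (P m) → L v m ≈ 1#)
                  × (¬ (v ∈ₗ List⁺.toList (P m)) → L v m ≈ 0#))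
         × (∀ m m' → m ≢ m' → ∀ v → v ∈ₗ List⁺.toList (P m) → ¬ (v ∈ₗ List⁺.toList (P m'))))

-- Both halves of certifiability are read off the paths alone.  Every vertex v
-- gets a clique of size at most two: if v is the first vertex of its path P,
-- the row of v in L is the indicator of P's message, which v may send since it
-- lies in f(s); if v has a predecessor u on P, then u and v have equal rows, so
-- e_v − e_u annihilates L and {u, v} is an edge with π(u) < π(v); a vertex on no
-- path has a zero row.  For the rank, every path meets a multicut M in some
-- vertex w_j; since the paths are disjoint, the rows w_1, …, w_r of L form an
-- identity matrix, so Lᵀ I_M contains an r × r identity submatrix.
module Submission where

open import Defs
open import Level using (Level; _⊔_; 0ℓ) renaming (suc to lsuc)
open import Data.Nat as ℕ using (ℕ)

open import Algebra.Bundles using (CommutativeMonoid)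
import Algebra.Properties.Ring as RingProperties
open import Data.Bool using (if_then_else_)
open import Data.Empty using (⊥-elim)
open import Data.Fin as Fin using (Fin; zero; suc; _↑ˡ_; _↑ʳ_; splitAt; _≟_)
open import Data.Fin.Properties using (suc-injective; <-irrefl; splitAt⁻¹-↑ˡ; splitAt⁻¹-↑ʳ; any?)
open import Data.Fin.Subset using (Subset) renaming (_∈_ to _∈ₛ_)
open import Data.Fin.Permutation using (_⟨$⟩ʳ_)
open import Data.List using (List; _∷_)
open import Data.List.NonEmpty as List⁺ using (List⁺)
open import Data.List.Membership.Propositional using (_∈_; find)
open import Data.List.Relation.Unary.Any using (here; there)
open import Data.List.Relation.Unary.Linked as Linked using (Linked; _∷_)
open import Data.Product using (Σ-syntax; ∃-syntax; _×_; _,_; proj₁; proj₂)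
open import Data.Product.Properties using (≡-dec)
open import Data.Sum using (_⊎_; inj₁; inj₂)
open import Function using (Injective; _∘_)
open import Relation.Binary using (Rel; DecidableEquality)
open import Relation.Binary.PropositionalEquality as ≡ using (_≡_; _≢_; refl; cong)
open import Relation.Nullary using (¬_; yes; no; does)

module _ {a ℓ} {A : Set a} {R : Rel A ℓ} where

  ∈-Linked⇒head⊎predecessor : ∀ {x xs y} → Linked R (x ∷ xs) → y ∈ x ∷ xs →
                              y ≡ x ⊎ ∃[ u ] (u ∈ x ∷ xs × R u y)
  ∈-Linked⇒head⊎predecessor _          (here y≡x) = inj₁ y≡x
  ∈-Linked⇒head⊎predecessor (Rxz ∷ ls) (there y∈) with ∈-Linked⇒head⊎predecessor ls y∈
  ... | inj₁ refl            = inj₂ (_ , here refl , Rxz)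
  ... | inj₂ (u , u∈ , Ruy) = inj₂ (u , there u∈ , Ruy)

Msg-fromIndex : ∀ k (r : Fin k → ℕ) → Fin (sumFin ℕ._+_ 0 k r) → Msg r
Msg-fromIndex (ℕ.suc k) r j with splitAt (r zero) j
... | inj₁ j′ = zero , j′
... | inj₂ j′ = let (i , j″) = Msg-fromIndex k (λ i → r (suc i)) j′ in suc i , j″

Msg-toIndex : ∀ k (r : Fin k → ℕ) → Msg r → Fin (sumFin ℕ._+_ 0 k r)
Msg-toIndex (ℕ.suc k) r (zero  , j) = j ↑ˡ _
Msg-toIndex (ℕ.suc k) r (suc i , j) = r zero ↑ʳ Msg-toIndex k (λ i → r (suc i)) (i , j)

Msg-toIndex∘fromIndex : ∀ k r j → Msg-toIndex k r (Msg-fromIndex k r j) ≡ j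
Msg-toIndex∘fromIndex (ℕ.suc k) r j with splitAt (r zero) j in eq
... | inj₁ _ = splitAt⁻¹-↑ˡ eq
... | inj₂ j′ rewrite Msg-toIndex∘fromIndex k (λ i → r (suc i)) j′ = splitAt⁻¹-↑ʳ eq

Msg-fromIndex-injective : ∀ k r → Injective _≡_ _≡_ (Msg-fromIndex k r)
Msg-fromIndex-injective k r {i} {j} eq = begin
  i                                        ≡⟨ ≡.sym (Msg-toIndex∘fromIndex k r i) ⟩
  Msg-toIndex k r (Msg-fromIndex k r i)    ≡⟨ cong (Msg-toIndex k r) eq ⟩
  Msg-toIndex k r (Msg-fromIndex k r j)    ≡⟨ Msg-toIndex∘fromIndex k r j ⟩
  j                                        ∎
  where open ≡.≡-Reasoning

_≟ₘ_ : ∀ {k} {r : Fin k → ℕ} → DecidableEquality (Msg r)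
_≟ₘ_ = ≡-dec _≟_ _≟_

module _ {a ℓ} (M : CommutativeMonoid a ℓ) where
  open CommutativeMonoid M renaming (refl to ≈-refl; trans to ≈-trans)

  sumFin-zero : ∀ m {g : Fin m → Carrier} → (∀ j → g j ≈ ε) → sumFin _∙_ ε m g ≈ ε
  sumFin-zero ℕ.zero    g≈ε = ≈-refl
  sumFin-zero (ℕ.suc m) g≈ε =
    ≈-trans (∙-cong (g≈ε zero) (sumFin-zero m (λ j → g≈ε (suc j)))) (identityʳ ε)

  sumFin-single : ∀ m {g : Fin m → Carrier} j₀ → (∀ j → j ≢ j₀ → g j ≈ ε) →
                  sumFin _∙_ ε m g ≈ g j₀
  sumFin-single (ℕ.suc m) zero     g≈ε =
    ≈-trans (∙-congˡ (sumFin-zero m (λ j → g≈ε (suc j) λ ()))) (identityʳ _)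
  sumFin-single (ℕ.suc m) (suc j₀) g≈ε =
    ≈-trans (∙-cong (g≈ε zero λ ()) (sumFin-single m j₀ (λ j j≢j₀ → g≈ε (suc j) (j≢j₀ ∘ suc-injective))))
          (identityˡ _)

  sumFin-pair : ∀ m {g : Fin m → Carrier} u v → u ≢ v → (∀ j → j ≢ u → j ≢ v → g j ≈ ε) →
                sumFin _∙_ ε m g ≈ g u ∙ g v
  sumFin-pair (ℕ.suc m) zero    zero    u≢v _   = ⊥-elim (u≢v refl)
  sumFin-pair (ℕ.suc m) zero    (suc v) _   g≈ε =
    ∙-congˡ (sumFin-single m v (λ j j≢v → g≈ε (suc j) (λ ()) (j≢v ∘ suc-injective)))
  sumFin-pair (ℕ.suc m) (suc u) zero    _   g≈ε =
    ≈-trans (∙-congˡ (sumFin-single m u (λ j j≢u → g≈ε (suc j) (j≢u ∘ suc-injective) (λ ())))) (comm _ _)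
  sumFin-pair (ℕ.suc m) (suc u) (suc v) u≢v g≈ε =
    ≈-trans (∙-cong (g≈ε zero (λ ()) (λ ()))
                  (sumFin-pair m u v (u≢v ∘ cong suc)
                     (λ j j≢u j≢v → g≈ε (suc j) (j≢u ∘ suc-injective) (j≢v ∘ suc-injective))))
          (identityˡ _)

module _ {c ℓ} (F : FiniteField c ℓ) where
  open FiniteField F renaming (refl to ≈-refl; sym to ≈-sym; trans to ≈-trans)
  open import Relation.Binary.Reasoning.Setoid setoid

  RankAtLeast-identitySubmatrix :
    ∀ {R C ρ} (A : Matrix F R C) (row : Fin ρ → R) (col : Fin ρ → C) →
    (∀ i → A (row i) (col i) ≈ 1#) → (∀ i j → i ≢ j → A (row i) (col j) ≈ 0#) →
    RankAtLeast F A ρ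
  RankAtLeast-identitySubmatrix {ρ = ρ} A row col diag offDiag = col , col-injective , independent
    where
    col-injective : Injective _≡_ _≡_ col
    col-injective {i} {j} col-i≡col-j with i ≟ j
    ... | yes i≡j = i≡j
    ... | no  i≢j = ⊥-elim (1≉0 (begin
      1#                 ≈⟨ diag i ⟨
      A (row i) (col i)  ≡⟨ cong (A (row i)) col-i≡col-j ⟩
      A (row i) (col j)  ≈⟨ offDiag i j i≢j ⟩
      0#                 ∎))

    independent : ∀ λs → (∀ x → ∑ F ρ (λ j → λs j * A x (col j)) ≈ 0#) → ∀ i → λs i ≈ 0#
    independent λs combination≈0 i = begin
      λs i                                   ≈⟨ *-identityʳ (λs i) ⟨
      λs i * 1#                              ≈⟨ *-congˡ (diag i) ⟨
      λs i * A (row i) (col i)               ≈⟨ sumFin-single +-commutativeMonoid ρ i vanishes ⟨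
      ∑ F ρ (λ j → λs j * A (row i) (col j)) ≈⟨ combination≈0 (row i) ⟩
      0#                                     ∎
      where
      vanishes : ∀ j → j ≢ i → λs j * A (row i) (col j) ≈ 0#
      vanishes j j≢i = ≈-trans (*-congˡ (offDiag i j (j≢i ∘ ≡.sym))) (zeroʳ _)

  ᵀ·I-entry : ∀ {n X} (A : Matrix F (Fin n) X) (M : Subset n) x w (w∈M : w ∈ₛ M) →
              _·_ F (_ᵀ F A) (I[_] F M) x (w , w∈M) ≈ A w x
  ᵀ·I-entry {n} A M x w w∈M = ≈-trans
    (sumFin-single +-commutativeMonoid n w (λ u u≢w → ≈-trans (*-congˡ (I-off u u≢w)) (zeroʳ _)))
    (≈-trans (*-congˡ I-diag) (*-identityʳ _))
    where
    I-diag : I[_] F M w (w , w∈M) ≈ 1#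
    I-diag with w ≟ w
    ... | yes _  = ≈-refl
    ... | no w≢w = ⊥-elim (w≢w refl)

    I-off : ∀ u → u ≢ w → I[_] F M u (w , w∈M) ≈ 0#
    I-off u u≢w with u ≟ w
    ... | yes u≡w = ⊥-elim (u≢w u≡w)
    ... | no  _   = ≈-refl

  module _ {n k} (N : Instance n k) (C : Code F N) where
    open Instance N using (G; Adj; Adj-sym; fS)
    open Code C
    open import Data.List.Membership.DecPropositional (_≟_ {n}) using (_∈?_)

    CliqueCertificate : Fin n → Set (lsuc 0ℓ ⊔ c ⊔ ℓ)
    CliqueCertificate v = Σ[ K ∈ (Fin n → Set) ]
      ((∀ u → K u → Nbhd F N C v u) × IsClique G K × Requirement F N C v K)

    singletonCertificate : ∀ v → (∀ m → ¬ (L v m ≈ 0#) → v ∈ₛ fS (proj₁ m)) → CliqueCertificate v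
    singletonCertificate v sendable =
      (_≡ v) , (λ _ → inj₁) , (λ x y x≡v y≡v x≢y → ⊥-elim (x≢y (≡.trans x≡v (≡.sym y≡v)))) ,
      e , e-v≉0 , e-supp , (λ m e·L≉0 → sendable m (e·L≉0 ∘ ≈-trans (e·L≈L-row m)))
      where
      e : Fin n → Carrier
      e x = if does (x ≟ v) then 1# else 0#

      e-v≈1 : e v ≈ 1#
      e-v≈1 with v ≟ v
      ... | yes _   = ≈-refl
      ... | no  v≢v = ⊥-elim (v≢v refl)

      e-off : ∀ x → x ≢ v → e x ≈ 0#
      e-off x x≢v with x ≟ v
      ... | yes x≡v = ⊥-elim (x≢v x≡v)
      ... | no  _   = ≈-refl

      e-v≉0 : ¬ (e v ≈ 0#)
      e-v≉0 e-v≈0 = 1≉0 (≈-trans (≈-sym e-v≈1) e-v≈0)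

      e-supp : ∀ x → ¬ (e x ≈ 0#) → x ≡ v
      e-supp x e-x≉0 with x ≟ v
      ... | yes x≡v = x≡v
      ... | no  _   = ⊥-elim (e-x≉0 ≈-refl)

      e·L≈L-row : ∀ m → ∑ F n (λ x → e x * L x m) ≈ L v m
      e·L≈L-row m = ≈-trans
        (sumFin-single +-commutativeMonoid n v (λ x x≢v → ≈-trans (*-congʳ (e-off x x≢v)) (zeroˡ _)))
        (≈-trans (*-congʳ e-v≈1) (*-identityˡ _))

    edgeCertificate : ∀ {u v} → Adj u v → (π ⟨$⟩ʳ u) Fin.< (π ⟨$⟩ʳ v) → (∀ m → L v m ≈ L u m) →
                      CliqueCertificate v
    edgeCertificate {u} {v} uv∈E πu<πv rows-equal =
      K , K⊆Nbhd , K-clique , a , a-v≉0 , a-supp , (λ m a·L≉0 → ⊥-elim (a·L≉0 (a·L≈0 m)))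
      where
      u≢v : u ≢ v
      u≢v u≡v = <-irrefl (cong (π ⟨$⟩ʳ_) u≡v) πu<πv

      K : Fin n → Set
      K x = x ≡ v ⊎ x ≡ u

      K⊆Nbhd : ∀ x → K x → Nbhd F N C v x
      K⊆Nbhd x (inj₁ x≡v)  = inj₁ x≡v
      K⊆Nbhd x (inj₂ refl) = inj₂ (πu<πv , uv∈E)

      K-clique : IsClique G K
      K-clique _ _ (inj₁ refl) (inj₁ refl) x≢y = ⊥-elim (x≢y refl)
      K-clique _ _ (inj₁ refl) (inj₂ refl) _   = Adj-sym uv∈E
      K-clique _ _ (inj₂ refl) (inj₁ refl) _   = uv∈E
      K-clique _ _ (inj₂ refl) (inj₂ refl) x≢y = ⊥-elim (x≢y refl)

      a : Fin n → Carrier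
      a x = if does (x ≟ v) then 1# else if does (x ≟ u) then - 1# else 0#

      a-v≈1 : a v ≈ 1#
      a-v≈1 with v ≟ v
      ... | yes _   = ≈-refl
      ... | no  v≢v = ⊥-elim (v≢v refl)

      a-u≈-1 : a u ≈ - 1#
      a-u≈-1 with u ≟ v | u ≟ u
      ... | yes u≡v | _       = ⊥-elim (u≢v u≡v)
      ... | no  _   | yes _   = ≈-refl
      ... | no  _   | no  u≢u = ⊥-elim (u≢u refl)

      a-off : ∀ x → x ≢ v → x ≢ u → a x ≈ 0#
      a-off x x≢v x≢u with x ≟ v | x ≟ u
      ... | yes x≡v | _       = ⊥-elim (x≢v x≡v)
      ... | no  _   | yes x≡u = ⊥-elim (x≢u x≡u)
      ... | no  _   | no  _   = ≈-refl

      a-v≉0 : ¬ (a v ≈ 0#)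
      a-v≉0 a-v≈0 = 1≉0 (≈-trans (≈-sym a-v≈1) a-v≈0)

      a-supp : ∀ x → ¬ (a x ≈ 0#) → K x
      a-supp x a-x≉0 with x ≟ v | x ≟ u
      ... | yes x≡v | _       = inj₁ x≡v
      ... | no  _   | yes x≡u = inj₂ x≡u
      ... | no  _   | no  _   = ⊥-elim (a-x≉0 ≈-refl)

      a·L≈0 : ∀ m → ∑ F n (λ x → a x * L x m) ≈ 0#
      a·L≈0 m = begin
        ∑ F n (λ x → a x * L x m)   ≈⟨ sumFin-pair +-commutativeMonoid n v u (u≢v ∘ ≡.sym)
                                         (λ x x≢v x≢u → ≈-trans (*-congʳ (a-off x x≢v x≢u)) (zeroˡ _)) ⟩
        a v * L v m + a u * L u m   ≈⟨ +-cong (*-cong a-v≈1 (rows-equal m)) (*-congʳ a-u≈-1) ⟩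
        1# * L u m + - 1# * L u m   ≈⟨ +-cong (*-identityˡ _) (-1*x≈-x _) ⟩
        L u m + - L u m             ≈⟨ -‿inverseʳ _ ⟩
        0#                          ∎
        where open RingProperties ring using (-1*x≈-x)

    module _ (paths : DescribesDisjointPaths F N C) where

      path⁺ : Msg r → List⁺ (Fin n)
      path⁺ = proj₁ paths

      path : Msg r → List (Fin n)
      path m = List⁺.toList (path⁺ m)

      path-isPath : ∀ m → PathFor N (proj₁ m) (path⁺ m)
      path-isPath = proj₁ (proj₂ paths)

      path-π-increasing : ∀ m → Linked (λ u v → (π ⟨$⟩ʳ u) Fin.< (π ⟨$⟩ʳ v)) (path m)
      path-π-increasing = proj₁ (proj₂ (proj₂ paths))

      path-edges : ∀ m → Linked (λ u v → Adj u v × (π ⟨$⟩ʳ u) Fin.< (π ⟨$⟩ʳ v)) (path m)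
      path-edges m = Linked.zip (WalkFor.linked (PathFor.walk (path-isPath m)) , path-π-increasing m)

      L-onPath : ∀ {v m} → v ∈ path m → L v m ≈ 1#
      L-onPath {v} {m} = proj₁ (proj₁ (proj₂ (proj₂ (proj₂ paths))) v m)

      L-offPath : ∀ {v m} → ¬ (v ∈ path m) → L v m ≈ 0#
      L-offPath {v} {m} = proj₂ (proj₁ (proj₂ (proj₂ (proj₂ paths))) v m)

      L-otherPath : ∀ {v m m′} → v ∈ path m → m ≢ m′ → L v m′ ≈ 0#
      L-otherPath {v} {m} {m′} v∈m m≢m′ = L-offPath (proj₂ (proj₂ (proj₂ (proj₂ paths))) m m′ m≢m′ v v∈m)

      L-rows-equal-onPath : ∀ {u v m₀} → v ∈ path m₀ → u ∈ path m₀ → ∀ m → L v m ≈ L u m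
      L-rows-equal-onPath {m₀ = m₀} v∈m₀ u∈m₀ m with m₀ ≟ₘ m
      ... | yes refl  = ≈-trans (L-onPath v∈m₀) (≈-sym (L-onPath u∈m₀))
      ... | no  m₀≢m = ≈-trans (L-otherPath v∈m₀ m₀≢m) (≈-sym (L-otherPath u∈m₀ m₀≢m))

      vertexCertificate : ∀ v → CliqueCertificate v
      vertexCertificate v with any? (λ i → any? (λ j → v ∈? path (i , j)))
      ... | no v∉paths = singletonCertificate v λ m L-v-m≉0 →
              ⊥-elim (L-v-m≉0 (L-offPath λ v∈m → v∉paths (proj₁ m , proj₂ m , v∈m)))
      ... | yes (i , j , v∈m₀)
          with ∈-Linked⇒head⊎predecessor (path-edges (i , j)) v∈m₀
      ... | inj₂ (u , u∈m₀ , uv∈E , πu<πv) = edgeCertificate uv∈E πu<πv (L-rows-equal-onPath v∈m₀ u∈m₀)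
      ... | inj₁ refl = singletonCertificate v sendable
        where
        sendable : ∀ m → ¬ (L v m ≈ 0#) → v ∈ₛ fS (proj₁ m)
        sendable m L-v-m≉0 with (i , j) ≟ₘ m
        ... | yes refl = WalkFor.start (PathFor.walk (path-isPath (i , j)))
        ... | no  m₀≢m = ⊥-elim (L-v-m≉0 (L-otherPath v∈m₀ m₀≢m))

      multicutRank : ∀ M → IsMulticut N M →
                     RankAtLeast F (_·_ F (_ᵀ F L) (I[_] F M)) (totalMsgs F N C)
      multicutRank M isMulticut =
        RankAtLeast-identitySubmatrix (_·_ F (_ᵀ F L) (I[_] F M)) msg cutColumn
          (λ i → ≈-trans (cutColumn-entry i i) (L-onPath (cut∈path (msg i))))
          (λ i j i≢j → ≈-trans (cutColumn-entry i j)
                               (L-otherPath (cut∈path (msg j)) (i≢j ∘ ≡.sym ∘ Msg-fromIndex-injective k r)))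
        where
        msg : Fin (totalMsgs F N C) → Msg r
        msg = Msg-fromIndex k r

        cut : ∀ m → ∃[ w ] (w ∈ path m × w ∈ₛ M)
        cut m = find (isMulticut (proj₁ m) (path⁺ m) (PathFor.walk (path-isPath m)))

        cut∈path : ∀ m → proj₁ (cut m) ∈ path m
        cut∈path m = proj₁ (proj₂ (cut m))

        cutColumn : Fin (totalMsgs F N C) → Σ[ w ∈ Fin n ] w ∈ₛ M
        cutColumn j = proj₁ (cut (msg j)) , proj₂ (proj₂ (cut (msg j)))

        cutColumn-entry : ∀ i j →
                          _·_ F (_ᵀ F L) (I[_] F M) (msg i) (cutColumn j) ≈ L (proj₁ (cut (msg j))) (msg i)
        cutColumn-entry i j = ᵀ·I-entry L M (msg i) (proj₁ (cut (msg j))) (proj₂ (proj₂ (cut (msg j))))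

-- The clique certificates come from the paths alone, so the coefficient
-- vectors supplied by IsLinearCode are not needed.
mainTheorem5 : ∀ {c ℓ : Level} (F : FiniteField c ℓ) {n k : ℕ} (N : Instance n k)
    (C : Code F N) →
    IsLinearCode F N C →
    DescribesDisjointPaths F N C →
    Certifiable F N C (totalMsgs F N C)
mainTheorem5 F N C _ paths = (proj₁ ∘ certificate , proj₂ ∘ certificate) , multicutRank F N C paths
  where
  certificate : ∀ v → CliqueCertificate F N C v
  certificate = vertexCertificate F N C paths
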